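{- Let $1\leq m\leq k$ and $n\geq k+1$. Then $$op_{n,k}^m=\sum_{j=m+1}^{k+1}\sum_{i=1}^{n-k}c_i\,op_{n-i,k}^{j},$$ where $c_i=\frac{1}{i+1}\binom{2i}{i}$ is the $i$-th Catalan number and $op_{n,k}^m$ denotes the number of ordered preference sets of length $n$ with exactly $k$ flaws and leading term $m$.
   Context: Parking model: $n$ parking spaces numbered $1,\dots,n$ from left to right; a preference set of length $n$ is a sequence $(a_1,\dots,a_n)$ with $a_i\in[n]$. Cars arrive in order; car $i$ goes to space $a_i$, and if it is occupied, moves to the first unoccupied space to the right; if there is none, the car cannot park. The number of flaws is the number of cars that cannot park. A preference set is ordered if $a_1\leq\cdots\leq a_n$; its leading term is $a_1$. A count over an empty set is $0$ (e.g. $op_{n,k}^j=0$ if $n\leq k$). -}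

module Defs where

open import Data.Nat using (ℕ; zero; suc; _+_; _*_; _∸_; _≤_; _≤ᵇ_; _/_)



open import Data.Nat.Combinatorics using (_C_)
open import Data.Bool using (Bool; true; false; if_then_else_; _∧_)
open import Data.List using (List; []; _∷_; map; concatMap; length; filter)
open import Data.Nat.ListAction using (sum)
open import Data.Nat.Properties using (_≟_)
open import Relation.Nullary.Decidable using (⌊_⌋)
open import Data.Bool.Properties using (T?)

range : ℕ → ℕ → List ℕ
range a b = go (suc b ∸ a) a
  where
  go : ℕ → ℕ → List ℕ
  go zero    x = []
  go (suc k) x = x ∷ go k (suc x)

sumRange : ℕ → ℕ → (ℕ → ℕ) → ℕ
sumRange a b f = sum (map f (range a b))

sequences : ℕ → ℕ → List (List ℕ)
sequences n zero      = [] ∷ []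
sequences n (suc len) = concatMap (λ a → map (a ∷_) (sequences n len)) (range 1 n)

prefSets : ℕ → List (List ℕ)
prefSets n = sequences n n

open import Data.Maybe using (Maybe; just; nothing)
import Data.Maybe

-- parkAt s a : the street s is indexed from 1; the car prefers space a,
-- and takes the first unoccupied space at position ≥ a (positions ≤ 1 all mean
-- "start at the first space"; preferences are always ≥ 1 anyway).
parkAt : List Bool → ℕ → Maybe (List Bool)
parkAt []          _             = nothing
parkAt (b ∷ s)     (suc (suc a)) = Data.Maybe.map (b ∷_) (parkAt s (suc a))
parkAt (false ∷ s) zero          = just (true ∷ s)
parkAt (false ∷ s) (suc zero)    = just (true ∷ s)
parkAt (true ∷ s)  zero          = Data.Maybe.map (true ∷_) (parkAt s 1)
parkAt (true ∷ s)  (suc zero)    = Data.Maybe.map (true ∷_) (parkAt s 1)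

replicateFalse : ℕ → List Bool
replicateFalse zero    = []
replicateFalse (suc n) = false ∷ replicateFalse n

flawsFrom : List Bool → List ℕ → ℕ
flawsFrom s []           = 0
flawsFrom s (a ∷ prefs) with parkAt s a
... | just s' = flawsFrom s' prefs
... | nothing = suc (flawsFrom s prefs)

flaws : ℕ → List ℕ → ℕ
flaws n prefs = flawsFrom (replicateFalse n) prefs

isOrdered : List ℕ → Bool
isOrdered []            = true
isOrdered (a ∷ [])      = true
isOrdered (a ∷ b ∷ xs)  = (a ≤ᵇ b) ∧ isOrdered (b ∷ xs)

leadingIs : ℕ → List ℕ → Bool
leadingIs m []      = false
leadingIs m (a ∷ _) = ⌊ a ≟ m ⌋

op : ℕ → ℕ → ℕ → ℕ
op n k m = length (filter (λ p → T? (isOrdered p ∧ (⌊ flaws n p ≟ k ⌋ ∧ leadingIs m p)))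
                          (prefSets n))

catalan : ℕ → ℕ
catalan i = ((2 * i) C i) / suc i

-- The first car of an ordered preference set with leading term m parks at m, and the cars
-- after it, whose preferences are at least m, park at the end of the occupied block m, m + 1, …
-- until some car prefers a space beyond that block. If this happens after i - 1 cars, their
-- preferences form a weakly increasing sequence bounded by the growing end of the block; there
-- are c_i such sequences. Deleting the spaces m, …, m + i - 1 turns the remaining cars into an
-- ordered preference set of length n - i, with the same k flaws, whose leading term j exceeds m.
-- The terms with j > k + 1 vanish, since spaces 1, …, j - 1 then stay free, and so do those with
-- n - i < k, which leave fewer than k cars.

module Submission where

open import Defs
open import Algebra.Properties.CommutativeSemigroup using (interchange)
open import Data.Bool using (Bool; true; false; _∧_; if_then_else_; T)
open import Data.Bool.Properties using (T?; T-≡; ∧-zeroʳ; ∧-identityʳ)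
open import Data.List using (List; []; _∷_; _++_; map; length; filter; concatMap)
open import Data.List.Properties using (++-assoc; length-++)
open import Data.Maybe using (just; nothing)
import Data.Maybe as Maybe
import Data.Maybe.Properties as Maybe
open import Data.Nat
open import Data.Nat.Combinatorics using (_C_; nCk+nC[k+1]≡[n+1]C[k+1]; nCk≡nC[n∸k])
open import Data.Nat.DivMod using (m*n/n≡m)
open import Data.Nat.ListAction using (sum)
open import Data.Nat.Properties
open import Data.Nat.Tactic.RingSolver using (solve)
open import Function using (_∘_)
open import Function.Bundles using (module Equivalence)
open import Relation.Binary.PropositionalEquality
open import Relation.Nullary using (contradiction; yes; no)
open import Relation.Nullary.Decidable using (⌊_⌋; isYes≗does; dec-true; dec-false)
open ≡-Reasoning

sumFrom : (ℕ → ℕ) → ℕ → ℕ → ℕ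
sumFrom f x zero    = 0
sumFrom f x (suc c) = f x + sumFrom f (suc x) c

upFrom : ℕ → ℕ → List ℕ
upFrom zero    x = []
upFrom (suc c) x = x ∷ upFrom c (suc x)

suc-∸-injective : ∀ a b {c} → suc b ∸ a ≡ suc c → b ∸ a ≡ c
suc-∸-injective zero    b       eq = suc-injective eq
suc-∸-injective (suc a) zero    eq = contradiction (trans (sym (0∸n≡0 a)) eq) 0≢1+n
suc-∸-injective (suc a) (suc b) eq = suc-∸-injective a b eq

range≡upFrom : ∀ c a b → suc b ∸ a ≡ c → range a b ≡ upFrom c a
range≡upFrom zero    a b eq rewrite eq = refl
range≡upFrom (suc c) a b eq rewrite eq | sym (suc-∸-injective a b eq) =
  cong (a ∷_) (range≡upFrom (b ∸ a) (suc a) b refl)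

sumRange≡sumFrom : ∀ a b f → sumRange a b f ≡ sumFrom f a (suc b ∸ a)
sumRange≡sumFrom a b f =
  trans (cong (λ xs → sum (map f xs)) (range≡upFrom _ a b refl)) (sum-upFrom (suc b ∸ a) a)
  where
  sum-upFrom : ∀ c x → sum (map f (upFrom c x)) ≡ sumFrom f x c
  sum-upFrom zero    x = refl
  sum-upFrom (suc c) x = cong (f x +_) (sum-upFrom c (suc x))

module _ (f : ℕ → ℕ) where

  sumFrom-+ : ∀ x c e → sumFrom f x (c + e) ≡ sumFrom f x c + sumFrom f (x + c) e
  sumFrom-+ x zero    e rewrite +-identityʳ x = refl
  sumFrom-+ x (suc c) e rewrite +-suc x c =
    trans (cong (f x +_) (sumFrom-+ (suc x) c e)) (sym (+-assoc (f x) _ _))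

  sumFrom-suc : ∀ x c → sumFrom f x (suc c) ≡ sumFrom f x c + f (x + c)
  sumFrom-suc x c = begin
    sumFrom f x (suc c)              ≡⟨ cong (sumFrom f x) (+-comm 1 c) ⟩
    sumFrom f x (c + 1)              ≡⟨ sumFrom-+ x c 1 ⟩
    sumFrom f x c + (f (x + c) + 0)  ≡⟨ cong (sumFrom f x c +_) (+-identityʳ _) ⟩
    sumFrom f x c + f (x + c)        ∎

  sumFrom-shift : ∀ i x c → sumFrom f (i + x) c ≡ sumFrom (λ y → f (i + y)) x c
  sumFrom-shift i x zero    = refl
  sumFrom-shift i x (suc c) rewrite sym (+-suc i x) = cong (f (i + x) +_) (sumFrom-shift i (suc x) c)

  sumFrom-reverse : ∀ t b → sumFrom (λ a → f (b + t ∸ a)) b t ≡ sumFrom f 1 t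
  sumFrom-reverse zero    b = refl
  sumFrom-reverse (suc t) b = begin
    f (b + suc t ∸ b) + sumFrom (λ a → f (b + suc t ∸ a)) (suc b) t
      ≡⟨ cong₂ _+_ (cong f (m+n∸m≡n b (suc t)))
                   (cong (λ z → sumFrom (λ a → f (z ∸ a)) (suc b) t) (+-suc b t)) ⟩
    f (suc t) + sumFrom (λ a → f (suc b + t ∸ a)) (suc b) t
      ≡⟨ cong (f (suc t) +_) (sumFrom-reverse t (suc b)) ⟩
    f (suc t) + sumFrom f 1 t
      ≡⟨ +-comm (f (suc t)) _ ⟩
    sumFrom f 1 t + f (suc t)
      ≡⟨ sym (sumFrom-suc 1 t) ⟩
    sumFrom f 1 (suc t) ∎

sumFrom-cong : ∀ {f g} x c → (∀ y → x ≤ y → y < x + c → f y ≡ g y) → sumFrom f x c ≡ sumFrom g x c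
sumFrom-cong x zero    eq = refl
sumFrom-cong x (suc c) eq = cong₂ _+_ (eq x ≤-refl (m<m+n x (s≤s z≤n)))
  (sumFrom-cong (suc x) c (λ y x<y y<x+c → eq y (<⇒≤ x<y) (subst (y <_) (sym (+-suc x c)) y<x+c)))

sumFrom-zero : ∀ {f} x c → (∀ y → x ≤ y → y < x + c → f y ≡ 0) → sumFrom f x c ≡ 0
sumFrom-zero x c eq = trans (sumFrom-cong x c eq) (sumFrom-const₀ x c)
  where
  sumFrom-const₀ : ∀ x c → sumFrom (λ _ → 0) x c ≡ 0
  sumFrom-const₀ x zero    = refl
  sumFrom-const₀ x (suc c) = sumFrom-const₀ (suc x) c

sumFrom-truncate : ∀ {f} x c e → (∀ y → x + c ≤ y → y < x + c + e → f y ≡ 0) →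
                   sumFrom f x (c + e) ≡ sumFrom f x c
sumFrom-truncate {f} x c e eq = begin
  sumFrom f x (c + e)                  ≡⟨ sumFrom-+ f x c e ⟩
  sumFrom f x c + sumFrom f (x + c) e  ≡⟨ cong (sumFrom f x c +_) (sumFrom-zero (x + c) e eq) ⟩
  sumFrom f x c + 0                    ≡⟨ +-identityʳ _ ⟩
  sumFrom f x c                        ∎

sumFrom-single : ∀ {f} m n → 1 ≤ m → m ≤ n → (∀ a → 1 ≤ a → a ≤ n → a ≢ m → f a ≡ 0) →
                 sumFrom f 1 n ≡ f m
sumFrom-single {f} (suc m) n _ m<n eq = begin
  sumFrom f 1 n
    ≡⟨ cong (sumFrom f 1) (trans (sym (m+[n∸m]≡n m<n)) (sym (+-suc m (n ∸ suc m)))) ⟩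
  sumFrom f 1 (m + suc (n ∸ suc m))
    ≡⟨ sumFrom-+ f 1 m _ ⟩
  sumFrom f 1 m + (f (suc m) + sumFrom f (suc (suc m)) (n ∸ suc m))
    ≡⟨ cong₂ (λ x y → x + (f (suc m) + y)) (sumFrom-zero 1 m below) (sumFrom-zero (suc (suc m)) _ above) ⟩
  f (suc m) + 0
    ≡⟨ +-identityʳ _ ⟩
  f (suc m) ∎
  where
  below : ∀ a → 1 ≤ a → a < 1 + m → f a ≡ 0
  below a 1≤a a≤m = eq a 1≤a (≤-trans (<⇒≤ a≤m) m<n) (<⇒≢ a≤m)
  above : ∀ a → suc (suc m) ≤ a → a < suc (suc m) + (n ∸ suc m) → f a ≡ 0
  above a m<a a≤n = eq a (≤-trans (s≤s z≤n) m<a)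
    (≤-pred (subst (a <_) (cong suc (m+[n∸m]≡n m<n)) a≤n)) (λ a≡m → <⇒≢ m<a (sym a≡m))

sumFrom-distrib-+ : ∀ f g x c → sumFrom (λ y → f y + g y) x c ≡ sumFrom f x c + sumFrom g x c
sumFrom-distrib-+ f g x zero    = refl
sumFrom-distrib-+ f g x (suc c) rewrite sumFrom-distrib-+ f g (suc x) c = interchange +-commutativeSemigroup (f x) (g x) _ _

sumFrom-*ˡ : ∀ a f x c → sumFrom (λ y → a * f y) x c ≡ a * sumFrom f x c
sumFrom-*ˡ a f x zero    = sym (*-zeroʳ a)
sumFrom-*ˡ a f x (suc c) rewrite sumFrom-*ˡ a f (suc x) c = sym (*-distribˡ-+ a (f x) _)

sumFrom-comm : ∀ (h : ℕ → ℕ → ℕ) x c y e →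
               sumFrom (λ i → sumFrom (h i) y e) x c ≡ sumFrom (λ j → sumFrom (λ i → h i j) x c) y e
sumFrom-comm h x zero    y e = sym (sumFrom-zero y e (λ _ _ _ → refl))
sumFrom-comm h x (suc c) y e rewrite sumFrom-comm h (suc x) c y e =
  sym (sumFrom-distrib-+ (h x) (λ j → sumFrom (λ i → h i j) (suc x) c) y e)

sumRange-comm : ∀ a b c d (f : ℕ → ℕ → ℕ) →
  sumRange a b (λ j → sumRange c d (λ i → f i j)) ≡ sumFrom (λ i → sumFrom (f i) a (suc b ∸ a)) c (suc d ∸ c)
sumRange-comm a b c d f = begin
  sumRange a b (λ j → sumRange c d (λ i → f i j))
    ≡⟨ sumRange≡sumFrom a b _ ⟩
  sumFrom (λ j → sumRange c d (λ i → f i j)) a (suc b ∸ a)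
    ≡⟨ sumFrom-cong a (suc b ∸ a) (λ j _ _ → sumRange≡sumFrom c d (λ i → f i j)) ⟩
  sumFrom (λ j → sumFrom (λ i → f i j) c (suc d ∸ c)) a (suc b ∸ a)
    ≡⟨ sumFrom-comm (λ j i → f i j) a (suc b ∸ a) c (suc d ∸ c) ⟩
  sumFrom (λ i → sumFrom (f i) a (suc b ∸ a)) c (suc d ∸ c) ∎

-- Ballot numbers and the Catalan numbers

-- ballot d s counts the weakly increasing preferences of s cars that all park at the end of a
-- growing block when the first car has d + 1 admissible preferences; ballot 0 gives the Catalan numbers.
ballot : ℕ → ℕ → ℕ
ballot d zero    = 1
ballot d (suc s) = sumFrom (λ d′ → ballot d′ s) 1 (suc d)

ballot-suc : ∀ d s → ballot (suc d) (suc s) ≡ ballot d (suc s) + ballot (suc (suc d)) s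
ballot-suc d s = sumFrom-suc (λ d′ → ballot d′ s) 1 (suc d)

_C⁻_ : ℕ → ℕ → ℕ
N C⁻ zero  = 0
N C⁻ suc s = N C s

pascal : ∀ n k → suc n C suc k ≡ n C k + n C suc k
pascal n k = sym (nCk+nC[k+1]≡[n+1]C[k+1] n k)

pascal⁻ : ∀ n s → suc n C s ≡ n C⁻ s + n C s
pascal⁻ n zero    = refl
pascal⁻ n (suc s) = pascal n s

nCj≡nCk : ∀ {n} k j → k + j ≡ n → n C j ≡ n C k
nCj≡nCk {n} k j k+j≡n = begin
  n C j        ≡⟨ cong (n C_) (sym (trans (cong (_∸ k) (sym k+j≡n)) (m+n∸m≡n k j))) ⟩
  n C (n ∸ k)  ≡⟨ sym (nCk≡nC[n∸k] (subst (k ≤_) k+j≡n (m≤m+n k j))) ⟩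
  n C k        ∎

ballot+C⁻≡C : ∀ s d {N} → s + s + d ≡ N → ballot d s + N C⁻ s ≡ N C s
ballot+C⁻≡C zero    d       _  = refl
ballot+C⁻≡C (suc s) zero    {suc N} eq = begin
    ballot 1 s + 0 + suc N C s      ≡⟨ cong (_+ suc N C s) (+-identityʳ _) ⟩
    ballot 1 s + suc N C s          ≡⟨ cong (ballot 1 s +_) (pascal⁻ N s) ⟩
    ballot 1 s + (N C⁻ s + N C s)   ≡⟨ sym (+-assoc (ballot 1 s) _ _) ⟩
    ballot 1 s + N C⁻ s + N C s     ≡⟨ cong (_+ N C s) (ballot+C⁻≡C s 1 s+s+1≡N) ⟩
    N C s + N C s                   ≡⟨ cong (N C s +_) (nCj≡nCk (suc s) s (trans (+-comm 1 (s + s)) s+s+1≡N)) ⟩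
    N C s + N C suc s               ≡⟨ sym (pascal N s) ⟩
    suc N C suc s                   ∎
  where
  s+s+1≡N : s + s + 1 ≡ N
  s+s+1≡N = begin s + s + 1 ≡⟨ solve (s ∷ []) ⟩ s + suc s + 0 ≡⟨ suc-injective eq ⟩ N ∎
ballot+C⁻≡C (suc s) (suc d) {suc N} eq = begin
    ballot (suc d) (suc s) + suc N C s
  ≡⟨ cong₂ _+_ (ballot-suc d s) (pascal⁻ N s) ⟩
    A + B + (N C⁻ s + N C s)
  ≡⟨ +-assoc A B _ ⟩
    A + (B + (N C⁻ s + N C s))
  ≡⟨ cong (A +_) (sym (+-assoc B _ _)) ⟩
    A + (B + N C⁻ s + N C s)
  ≡⟨ sym (+-assoc A _ _) ⟩
    A + (B + N C⁻ s) + N C s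
  ≡⟨ cong (λ x → A + x + N C s) (ballot+C⁻≡C s (suc (suc d)) N≡′) ⟩
    A + N C s + N C s
  ≡⟨ cong (_+ N C s) (ballot+C⁻≡C (suc s) d N≡) ⟩
    N C suc s + N C s
  ≡⟨ trans (+-comm (N C suc s) (N C s)) (sym (pascal N s)) ⟩
    suc N C suc s ∎
  where
  A : ℕ
  A = ballot d (suc s)
  B : ℕ
  B = ballot (suc (suc d)) s
  N≡ : suc s + suc s + d ≡ N
  N≡ = begin suc s + suc s + d ≡⟨ solve (s ∷ d ∷ []) ⟩ s + suc s + suc d ≡⟨ suc-injective eq ⟩ N ∎
  N≡′ : s + s + suc (suc d) ≡ N
  N≡′ = begin s + s + suc (suc d) ≡⟨ solve (s ∷ d ∷ []) ⟩ suc s + suc s + d ≡⟨ N≡ ⟩ N ∎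

[1+k]*[1+n]C[1+k]≡[1+n]*nCk : ∀ n k → suc k * (suc n C suc k) ≡ suc n * (n C k)
[1+k]*[1+n]C[1+k]≡[1+n]*nCk zero    zero    = refl
[1+k]*[1+n]C[1+k]≡[1+n]*nCk zero    (suc k) = *-zeroʳ (suc (suc k))
[1+k]*[1+n]C[1+k]≡[1+n]*nCk (suc n) zero    = begin
  1 * (suc (suc n) C 1)      ≡⟨ *-identityˡ _ ⟩
  suc (suc n) C 1            ≡⟨ pascal (suc n) 0 ⟩
  1 + suc n C 1              ≡⟨ cong suc (trans (sym (*-identityˡ _)) ([1+k]*[1+n]C[1+k]≡[1+n]*nCk n 0)) ⟩
  1 + suc n * 1              ≡⟨⟩
  suc (suc n) * 1            ∎
[1+k]*[1+n]C[1+k]≡[1+n]*nCk (suc n) (suc k) = begin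
  suc (suc k) * (suc (suc n) C suc (suc k))    ≡⟨ cong (suc (suc k) *_) (pascal (suc n) (suc k)) ⟩
  suc (suc k) * (X + Y)                        ≡⟨ *-distribˡ-+ (suc (suc k)) X Y ⟩
  X + suc k * X + suc (suc k) * Y              ≡⟨ cong₂ (λ a b → X + a + b) ([1+k]*[1+n]C[1+k]≡[1+n]*nCk n k)
                                                                         ([1+k]*[1+n]C[1+k]≡[1+n]*nCk n (suc k)) ⟩
  X + suc n * (n C k) + suc n * (n C suc k)    ≡⟨ +-assoc X _ _ ⟩
  X + (suc n * (n C k) + suc n * (n C suc k))  ≡⟨ cong (X +_) (sym (*-distribˡ-+ (suc n) (n C k) (n C suc k))) ⟩
  X + suc n * (n C k + n C suc k)              ≡⟨ cong (λ z → X + suc n * z) (sym (pascal n k)) ⟩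
  X + suc n * X                                ∎
  where
  X : ℕ
  X = suc n C suc k
  Y : ℕ
  Y = suc n C suc (suc k)

[1+j]*[2+2j]C[1+j]≡[2+j]*[2+2j]Cj : ∀ j → suc j * (2 * suc j C suc j) ≡ suc (suc j) * (2 * suc j C j)
[1+j]*[2+2j]C[1+j]≡[2+j]*[2+2j]Cj j = begin
  suc j * (2 * suc j C suc j)          ≡⟨ cong (λ n → suc j * (n C suc j)) 2+2j≡1+N ⟩
  suc j * (suc N C suc j)              ≡⟨ [1+k]*[1+n]C[1+k]≡[1+n]*nCk N j ⟩
  suc N * (N C j)                      ≡⟨ cong (suc N *_) (nCj≡nCk (suc j) j (sym (+-suc j j))) ⟩
  suc N * (N C suc j)                  ≡⟨ sym ([1+k]*[1+n]C[1+k]≡[1+n]*nCk N (suc j)) ⟩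
  suc (suc j) * (suc N C suc (suc j))  ≡⟨ cong (suc (suc j) *_) (sym (nCj≡nCk (suc (suc j)) j (cong suc (sym (+-suc j j))))) ⟩
  suc (suc j) * (suc N C j)            ≡⟨ cong (λ n → suc (suc j) * (n C j)) (sym 2+2j≡1+N) ⟩
  suc (suc j) * (2 * suc j C j)        ∎
  where
  N : ℕ
  N = j + suc j
  2+2j≡1+N : 2 * suc j ≡ suc (j + suc j)
  2+2j≡1+N = solve (j ∷ [])

[1+i]*ballot0≡2iCi : ∀ i → suc i * ballot 0 i ≡ 2 * i C i
[1+i]*ballot0≡2iCi zero    = refl
[1+i]*ballot0≡2iCi (suc j) = +-cancelʳ-≡ _ _ _ (begin
  suc i * ballot 0 i + suc i * (N C j)  ≡⟨ sym (*-distribˡ-+ (suc i) (ballot 0 i) (N C j)) ⟩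
  suc i * (ballot 0 i + N C j)          ≡⟨ cong (suc i *_) (ballot+C⁻≡C i 0 i+i+0≡2i) ⟩
  suc i * (N C i)                       ≡⟨ cong (N C i +_) ([1+j]*[2+2j]C[1+j]≡[2+j]*[2+2j]Cj j) ⟩
  N C i + suc i * (N C j)               ∎)
  where
  i : ℕ
  i = suc j
  N : ℕ
  N = 2 * i
  i+i+0≡2i : i + i + 0 ≡ 2 * i
  i+i+0≡2i = trans (+-identityʳ (i + i)) (cong (i +_) (sym (+-identityʳ i)))

catalan≡ballot0 : ∀ i → catalan i ≡ ballot 0 i
catalan≡ballot0 i = begin
  (2 * i C i) / suc i          ≡⟨ cong (_/ suc i) (sym ([1+i]*ballot0≡2iCi i)) ⟩
  (suc i * ballot 0 i) / suc i ≡⟨ cong (_/ suc i) (*-comm (suc i) (ballot 0 i)) ⟩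
  (ballot 0 i * suc i) / suc i ≡⟨ m*n/n≡m (ballot 0 i) (suc i) ⟩
  ballot 0 i                   ∎

catalan-suc≡ballot1 : ∀ s → catalan (suc s) ≡ ballot 1 s
catalan-suc≡ballot1 s = trans (catalan≡ballot0 (suc s)) (+-identityʳ (ballot 1 s))

-- Counting the completions of a partially parked street

≤ᵇ≡true⇒≤ : ∀ {m n} → (m ≤ᵇ n) ≡ true → m ≤ n
≤ᵇ≡true⇒≤ eq = ≤ᵇ⇒≤ _ _ (Equivalence.from T-≡ eq)

<ᵇ≡true⇒< : ∀ {m n} → (m <ᵇ n) ≡ true → m < n
<ᵇ≡true⇒< eq = <ᵇ⇒< _ _ (Equivalence.from T-≡ eq)

≤⇒≤ᵇ≡true : ∀ {m n} → m ≤ n → (m ≤ᵇ n) ≡ true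
≤⇒≤ᵇ≡true m≤n = Equivalence.to T-≡ (≤⇒≤ᵇ m≤n)

<⇒<ᵇ≡true : ∀ {m n} → m < n → (m <ᵇ n) ≡ true
<⇒<ᵇ≡true m<n = Equivalence.to T-≡ (<⇒<ᵇ m<n)

≤ᵇ≡false⇒> : ∀ {m n} → (m ≤ᵇ n) ≡ false → n < m
≤ᵇ≡false⇒> eq = ≰⇒> (λ m≤n → subst T eq (≤⇒≤ᵇ m≤n))

<ᵇ≡false⇒≥ : ∀ {m n} → (m <ᵇ n) ≡ false → n ≤ m
<ᵇ≡false⇒≥ eq = ≮⇒≥ (λ m<n → subst T eq (<⇒<ᵇ m<n))

>⇒≤ᵇ≡false : ∀ {m n} → n < m → (m ≤ᵇ n) ≡ false
>⇒≤ᵇ≡false {m} {n} n<m with m ≤ᵇ n in eq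
... | true  = contradiction (≤ᵇ≡true⇒≤ eq) (<⇒≱ n<m)
... | false = refl

≥⇒<ᵇ≡false : ∀ {m n} → n ≤ m → (m <ᵇ n) ≡ false
≥⇒<ᵇ≡false {m} {n} n≤m with m <ᵇ n in eq
... | true  = contradiction (<ᵇ≡true⇒< eq) (≤⇒≯ n≤m)
... | false = refl

countEmpty : ℕ → ℕ
countEmpty zero    = 1
countEmpty (suc _) = 0

-- A car that cannot park is one flaw, so the remaining cars must make one flaw fewer.
atPred : (ℕ → ℕ) → ℕ → ℕ
atPred g zero    = 0
atPred g (suc k) = g k

-- completions n q b len k counts the continuations by len cars of an ordered preference set
-- whose last entry is b that make k flaws, on a street of n spaces in which spaces b, …, q
-- are occupied and the spaces after q are free (see count≡completions).
mutual
  completions : ℕ → ℕ → ℕ → ℕ → ℕ → ℕ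
  completions n q b zero      k = countEmpty k
  completions n q b (suc len) k = sumFrom (nextCar n q b len k) 1 n

  nextCar : ℕ → ℕ → ℕ → ℕ → ℕ → ℕ → ℕ
  nextCar n q b len k a =
    if b ≤ᵇ a
      then (if a ≤ᵇ q
              then (if q <ᵇ n then completions n (suc q) a len k else atPred (completions n q a len) k)
              else completions n a a len k)
      else 0

completions-full : ∀ len n b k → k ≢ len → completions n n b len k ≡ 0
completions-full zero      n b zero    k≢0 = contradiction refl k≢0
completions-full zero      n b (suc k) _   = refl
completions-full (suc len) n b k k≢len = sumFrom-zero 1 n nextCar≡0
  where
  nextCar≡0 : ∀ a → 1 ≤ a → a < 1 + n → nextCar n n b len k a ≡ 0
  nextCar≡0 a _ a≤n with b ≤ᵇ a
  ... | false = refl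
  ... | true rewrite ≤⇒≤ᵇ≡true (≤-pred a≤n) | ≥⇒<ᵇ≡false (≤-refl {n}) = flawed k k≢len
    where
    flawed : ∀ k → k ≢ suc len → atPred (completions n n a len) k ≡ 0
    flawed zero    _ = refl
    flawed (suc k) k≢len = completions-full len n a k (k≢len ∘ cong suc)

completions-len<k : ∀ len n q b k → len < k → completions n q b len k ≡ 0
completions-len<k zero      n q b (suc k) _     = refl
completions-len<k (suc len) n q b k       len<k = sumFrom-zero 1 n nextCar≡0
  where
  len<k′ : len < k
  len<k′ = <-trans (n<1+n len) len<k
  nextCar≡0 : ∀ a → 1 ≤ a → a < 1 + n → nextCar n q b len k a ≡ 0
  nextCar≡0 a _ _ with b ≤ᵇ a
  ... | false = refl
  ... | true with a ≤ᵇ q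
  ...   | false = completions-len<k len n a a k len<k′
  ...   | true with q <ᵇ n
  ...     | true  = completions-len<k len n (suc q) a k len<k′
  ...     | false = flawed k len<k
    where
    flawed : ∀ k → suc len < k → atPred (completions n q a len) k ≡ 0
    flawed (suc k) (s≤s len<k) = completions-len<k len n q a k len<k

-- With only r free spaces left, at least len ∸ r of the len cars are flaws.
completions-free<len∸k : ∀ len n q b k r → q + r ≡ n → k + r < len → completions n q b len k ≡ 0
completions-free<len∸k (suc len) n q b k r q+r≡n k+r≤len = sumFrom-zero 1 n nextCar≡0
  where
  nextCar≡0 : ∀ a → 1 ≤ a → a < 1 + n → nextCar n q b len k a ≡ 0
  nextCar≡0 a _ a≤n with b ≤ᵇ a
  ... | false = refl
  ... | true with a ≤ᵇ q in a≤ᵇq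
  ...   | false = completions-free<len∸k len n a a k (n ∸ a) (m+[n∸m]≡n (≤-pred a≤n))
                    (≤-pred (≤-trans (s≤s (+-monoʳ-< k fewer)) k+r≤len))
    where
    fewer : n ∸ a < r
    fewer = +-cancelˡ-< q (n ∸ a) r (subst (q + (n ∸ a) <_) (trans (m+[n∸m]≡n (≤-pred a≤n)) (sym q+r≡n))
                                           (+-monoˡ-< (n ∸ a) (≤ᵇ≡false⇒> a≤ᵇq)))
  ...   | true with q <ᵇ n in q<ᵇn
  ...     | true = completions-free<len∸k len n (suc q) a k (r ∸ 1) q+1+r′≡n
                     (≤-pred (subst (_< suc len) (trans (cong (k +_) r≡1+r′) (+-suc k (r ∸ 1))) k+r≤len))
    where
    r≡1+r′ : r ≡ suc (r ∸ 1)
    r≡1+r′ = sym (suc-pred r {{≢-nonZero (λ r≡0 → <⇒≢ (<ᵇ≡true⇒< q<ᵇn)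
               (trans (sym (+-identityʳ q)) (trans (cong (q +_) (sym r≡0)) q+r≡n)))}})
    q+1+r′≡n : suc q + (r ∸ 1) ≡ n
    q+1+r′≡n = trans (sym (+-suc q (r ∸ 1))) (trans (cong (q +_) (sym r≡1+r′)) q+r≡n)
  ...     | false = flawed k k+r≤len
    where
    flawed : ∀ k → k + r < suc len → atPred (completions n q a len) k ≡ 0
    flawed zero    _           = refl
    flawed (suc k) (s≤s k+r≤len) = completions-free<len∸k len n q a k r q+r≡n k+r≤len

suc-cancel-≤ᵇ : ∀ x y → (suc x ≤ᵇ suc y) ≡ (x ≤ᵇ y)
suc-cancel-≤ᵇ zero    y = refl
suc-cancel-≤ᵇ (suc x) y = refl

+-cancelˡ-≤ᵇ : ∀ i x y → (i + x ≤ᵇ i + y) ≡ (x ≤ᵇ y)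
+-cancelˡ-≤ᵇ zero    x y = refl
+-cancelˡ-≤ᵇ (suc i) x y = trans (suc-cancel-≤ᵇ (i + x) (i + y)) (+-cancelˡ-≤ᵇ i x y)

+-cancelˡ-<ᵇ : ∀ i x y → (i + x <ᵇ i + y) ≡ (x <ᵇ y)
+-cancelˡ-<ᵇ zero    x y = refl
+-cancelˡ-<ᵇ (suc i) x y = +-cancelˡ-<ᵇ i x y

completions-shift : ∀ len i n q b k → 1 ≤ b → completions (i + n) (i + q) (i + b) len k ≡ completions n q b len k
completions-shift zero      i n q b k _   = refl
completions-shift (suc len) i n q b k 1≤b = begin
  sumFrom f 1 (i + n)                  ≡⟨ sumFrom-+ f 1 i n ⟩
  sumFrom f 1 i + sumFrom f (1 + i) n  ≡⟨ cong₂ _+_ (sumFrom-zero 1 i below) (cong (λ x → sumFrom f x n) (+-comm 1 i)) ⟩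
  sumFrom f (i + 1) n                  ≡⟨ sumFrom-shift f i 1 n ⟩
  sumFrom (λ y → f (i + y)) 1 n        ≡⟨ sumFrom-cong 1 n shifted ⟩
  sumFrom (nextCar n q b len k) 1 n    ∎
  where
  f : ℕ → ℕ
  f = nextCar (i + n) (i + q) (i + b) len k
  below : ∀ a → 1 ≤ a → a < 1 + i → f a ≡ 0
  below a _ a≤i rewrite >⇒≤ᵇ≡false {i + b} {a} (≤-trans a≤i (subst (_≤ i + b) (+-comm i 1) (+-monoʳ-≤ i 1≤b))) = refl
  shifted : ∀ y → 1 ≤ y → y < 1 + n → f (i + y) ≡ nextCar n q b len k y
  shifted y 1≤y _ rewrite +-cancelˡ-≤ᵇ i b y | +-cancelˡ-≤ᵇ i y q | +-cancelˡ-<ᵇ i q n with b ≤ᵇ y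
  ... | false = refl
  ... | true with y ≤ᵇ q
  ...   | false = completions-shift len i n y y k 1≤y
  ...   | true with q <ᵇ n
  ...     | true rewrite sym (+-suc i q) = completions-shift len i n (suc q) y k 1≤y
  ...     | false = flawed k
    where
    flawed : ∀ k → atPred (completions (i + n) (i + q) (i + y) len) k ≡ atPred (completions n q y len) k
    flawed zero    = refl
    flawed (suc k) = completions-shift len i n q y k 1≤y

jumpCompletions : ℕ → ℕ → ℕ → ℕ → ℕ
jumpCompletions n q len k = sumFrom (λ a → completions n a a len k) (suc (suc q)) (n ∸ suc q)

completions-suc : ∀ n q b d len k → q < n → suc b + d ≡ suc q →
  completions n q (suc b) (suc len) k ≡
  sumFrom (λ a → completions n (suc q) a len k) (suc b) (suc d) + jumpCompletions n q len k
completions-suc n q b d len k q<n 1+b+d≡1+q = begin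
  sumFrom f 1 n
    ≡⟨ cong (sumFrom f 1) n≡b+[1+d+r] ⟩
  sumFrom f 1 (b + (suc d + r))
    ≡⟨ sumFrom-+ f 1 b (suc d + r) ⟩
  sumFrom f 1 b + sumFrom f (suc b) (suc d + r)
    ≡⟨ cong₂ _+_ (sumFrom-zero 1 b below) (sumFrom-+ f (suc b) (suc d) r) ⟩
  sumFrom f (suc b) (suc d) + sumFrom f (suc b + suc d) r
    ≡⟨ cong₂ _+_ (sumFrom-cong (suc b) (suc d) block)
                 (trans (cong (λ x → sumFrom f x r) 1+b+1+d≡2+q) (sumFrom-cong (suc (suc q)) r beyond)) ⟩
  sumFrom (λ a → completions n (suc q) a len k) (suc b) (suc d) + jumpCompletions n q len k ∎
  where
  f : ℕ → ℕ
  f = nextCar n q (suc b) len k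
  r : ℕ
  r = n ∸ suc q
  n≡b+[1+d+r] : n ≡ b + (suc d + r)
  n≡b+[1+d+r] = begin
    n               ≡⟨ sym (m+[n∸m]≡n q<n) ⟩
    suc q + r       ≡⟨ cong (_+ r) (sym 1+b+d≡1+q) ⟩
    suc b + d + r   ≡⟨ cong (_+ r) (sym (+-suc b d)) ⟩
    b + suc d + r   ≡⟨ +-assoc b (suc d) r ⟩
    b + (suc d + r) ∎
  1+b+1+d≡2+q : suc b + suc d ≡ suc (suc q)
  1+b+1+d≡2+q = trans (+-suc (suc b) d) (cong suc 1+b+d≡1+q)
  below : ∀ a → 1 ≤ a → a < 1 + b → f a ≡ 0
  below a _ a≤b rewrite >⇒≤ᵇ≡false {suc b} {a} a≤b = refl
  block : ∀ a → suc b ≤ a → a < suc b + suc d → f a ≡ completions n (suc q) a len k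
  block a b<a a<b+d rewrite ≤⇒≤ᵇ≡true b<a with a ≤ᵇ q in a≤ᵇq
  ... | true rewrite <⇒<ᵇ≡true q<n = refl
  ... | false = cong (λ x → completions n x a len k)
                  (≤-antisym (≤-pred (subst (a <_) 1+b+1+d≡2+q a<b+d)) (≤ᵇ≡false⇒> a≤ᵇq))
  beyond : ∀ a → suc (suc q) ≤ a → a < suc (suc q) + r → f a ≡ completions n a a len k
  beyond a q<a _ rewrite ≤⇒≤ᵇ≡true {suc b} {a} (≤-trans (subst (suc b ≤_) 1+b+1+d≡2+q (m≤m+n (suc b) (suc d))) q<a)
                       | >⇒≤ᵇ≡false {a} {q} (<-trans (n<1+n q) q<a) = refl

-- Split according to the number s of cars that park at the end of the block before some car
-- parks beyond it; k ≢ len ∸ j excludes the continuations that fill all j free spaces this way.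
completions≡ballot-sum : ∀ n q b d len k j → q + j ≡ n → b + d ≡ suc q → 1 ≤ b → j ≤ len → k ≢ len ∸ j →
  completions n q b len k ≡ sumFrom (λ s → ballot d s * jumpCompletions n (q + s) (len ∸ suc s) k) 0 j
completions≡ballot-sum n q b d len k zero q+0≡n _ _ _ k≢len =
  subst (λ x → completions x q b len k ≡ 0) (trans (sym (+-identityʳ q)) q+0≡n) (completions-full len q b k k≢len)
completions≡ballot-sum n q (suc b) d (suc len) k (suc j) q+1+j≡n 1+b+d≡1+q _ (s≤s j≤len) k≢len = begin
  completions n q (suc b) (suc len) k
    ≡⟨ completions-suc n q b d len k q<n 1+b+d≡1+q ⟩
  sumFrom (λ a → completions n (suc q) a len k) (suc b) (suc d) + jumps 0
    ≡⟨ cong (_+ jumps 0) (sumFrom-cong (suc b) (suc d) afterBlock) ⟩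
  sumFrom (λ a → sumFrom (h a) 0 j) (suc b) (suc d) + jumps 0
    ≡⟨ cong (_+ jumps 0) (sumFrom-comm h (suc b) (suc d) 0 j) ⟩
  sumFrom (λ s → sumFrom (λ a → h a s) (suc b) (suc d)) 0 j + jumps 0
    ≡⟨ cong (_+ jumps 0) (sumFrom-cong 0 j (λ s _ _ → ballot-block s)) ⟩
  sumFrom (λ s → ballot d (suc s) * jumps (suc s)) 0 j + jumps 0
    ≡⟨ +-comm _ (jumps 0) ⟩
  jumps 0 + sumFrom (λ s → ballot d (suc s) * jumps (suc s)) 0 j
    ≡⟨ cong₂ _+_ (sym (*-identityˡ (jumps 0))) (sym (sumFrom-shift term 1 0 j)) ⟩
  sumFrom term 0 (suc j)
    ≡⟨ sumFrom-cong 0 (suc j) (λ s _ _ → cong (λ x → ballot d s * jumpCompletions n x (len ∸ s) k) (+-comm s q)) ⟩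
  sumFrom (λ s → ballot d s * jumpCompletions n (q + s) (suc len ∸ suc s) k) 0 (suc j) ∎
  where
  jumps : ℕ → ℕ
  jumps s = jumpCompletions n (s + q) (len ∸ s) k
  term : ℕ → ℕ
  term s = ballot d s * jumps s
  q<n : q < n
  q<n = subst (q <_) q+1+j≡n (m<m+n q (s≤s z≤n))
  h : ℕ → ℕ → ℕ
  h a s = ballot (suc (suc q) ∸ a) s * jumps (suc s)
  1+b+1+d≡2+q : suc b + suc d ≡ suc (suc q)
  1+b+1+d≡2+q = trans (+-suc (suc b) d) (cong suc 1+b+d≡1+q)
  afterBlock : ∀ a → suc b ≤ a → a < suc b + suc d → completions n (suc q) a len k ≡ sumFrom (h a) 0 j
  afterBlock a b<a a<b+d = trans
    (completions≡ballot-sum n (suc q) a (suc (suc q) ∸ a) len k j (trans (sym (+-suc q j)) q+1+j≡n)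
       (m+[n∸m]≡n (<⇒≤ (subst (a <_) 1+b+1+d≡2+q a<b+d))) (≤-trans (s≤s z≤n) b<a) j≤len k≢len)
    (sumFrom-cong 0 j (λ s _ _ → cong (λ x → ballot (suc (suc q) ∸ a) s * jumpCompletions n x (len ∸ suc s) k)
                                      (cong suc (+-comm q s))))
  ballot-block : ∀ s → sumFrom (λ a → h a s) (suc b) (suc d) ≡ ballot d (suc s) * jumps (suc s)
  ballot-block s = begin
    sumFrom (λ a → ballot (suc (suc q) ∸ a) s * jumps (suc s)) (suc b) (suc d)
      ≡⟨ sumFrom-cong (suc b) (suc d) (λ a _ _ → *-comm (ballot (suc (suc q) ∸ a) s) (jumps (suc s))) ⟩
    sumFrom (λ a → jumps (suc s) * ballot (suc (suc q) ∸ a) s) (suc b) (suc d)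
      ≡⟨ sumFrom-*ˡ (jumps (suc s)) (λ a → ballot (suc (suc q) ∸ a) s) (suc b) (suc d) ⟩
    jumps (suc s) * sumFrom (λ a → ballot (suc (suc q) ∸ a) s) (suc b) (suc d)
      ≡⟨ cong (λ x → jumps (suc s) * sumFrom (λ a → ballot (x ∸ a) s) (suc b) (suc d)) (sym 1+b+1+d≡2+q) ⟩
    jumps (suc s) * sumFrom (λ a → ballot (suc b + suc d ∸ a) s) (suc b) (suc d)
      ≡⟨ cong (jumps (suc s) *_) (sumFrom-reverse (λ d′ → ballot d′ s) (suc d) (suc b)) ⟩
    jumps (suc s) * ballot d (suc s)
      ≡⟨ *-comm (jumps (suc s)) _ ⟩
    ballot d (suc s) * jumps (suc s) ∎

count : {A : Set} → (A → Bool) → List A → ℕ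
count f []       = 0
count f (x ∷ xs) = if f x then suc (count f xs) else count f xs

module _ {A : Set} (f : A → Bool) where

  length-filter≡count : ∀ xs → length (filter (λ x → T? (f x)) xs) ≡ count f xs
  length-filter≡count []       = refl
  length-filter≡count (x ∷ xs) with f x
  ... | true  = cong suc (length-filter≡count xs)
  ... | false = length-filter≡count xs

  count-none : ∀ xs → (∀ x → f x ≡ false) → count f xs ≡ 0
  count-none []       _ = refl
  count-none (x ∷ xs) none rewrite none x = count-none xs none

  count-++ : ∀ xs ys → count f (xs ++ ys) ≡ count f xs + count f ys
  count-++ []       ys = refl
  count-++ (x ∷ xs) ys with f x
  ... | true  = cong suc (count-++ xs ys)
  ... | false = count-++ xs ys

  count-concatMap : ∀ {B : Set} (g : B → List A) xs → count f (concatMap g xs) ≡ sum (map (λ x → count f (g x)) xs)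
  count-concatMap g []       = refl
  count-concatMap g (x ∷ xs) = trans (count-++ (g x) _) (cong (count f (g x) +_) (count-concatMap g xs))

count-cong : ∀ {A : Set} {f g : A → Bool} xs → (∀ x → f x ≡ g x) → count f xs ≡ count g xs
count-cong []       eq = refl
count-cong {g = g} (x ∷ xs) eq rewrite eq x with g x
... | true  = cong suc (count-cong xs eq)
... | false = count-cong xs eq

count-map : ∀ {A B : Set} (f : B → Bool) (g : A → B) xs → count f (map g xs) ≡ count (λ x → f (g x)) xs
count-map f g []       = refl
count-map f g (x ∷ xs) with f (g x)
... | true  = cong suc (count-map f g xs)
... | false = count-map f g xs

count-sequences : ∀ (f : List ℕ → Bool) n len →
  count f (sequences n (suc len)) ≡ sumFrom (λ a → count (λ p → f (a ∷ p)) (sequences n len)) 1 n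
count-sequences f n len = begin
  count f (concatMap (λ a → map (a ∷_) (sequences n len)) (range 1 n))
    ≡⟨ count-concatMap f _ (range 1 n) ⟩
  sumRange 1 n (λ a → count f (map (a ∷_) (sequences n len)))
    ≡⟨ sumRange≡sumFrom 1 n _ ⟩
  sumFrom (λ a → count f (map (a ∷_) (sequences n len))) 1 n
    ≡⟨ sumFrom-cong 1 n (λ a _ _ → count-map f (a ∷_) (sequences n len)) ⟩
  sumFrom (λ a → count (λ p → f (a ∷ p)) (sequences n len)) 1 n ∎

-- Parking on a street

trues : ℕ → List Bool
trues zero    = []
trues (suc r) = true ∷ trues r

length-trues : ∀ r → length (trues r) ≡ r
length-trues zero    = refl
length-trues (suc r) = cong suc (length-trues r)

length-replicateFalse : ∀ f → length (replicateFalse f) ≡ f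
length-replicateFalse zero    = refl
length-replicateFalse (suc f) = cong suc (length-replicateFalse f)

replicateFalse-+ : ∀ e f → replicateFalse (e + f) ≡ replicateFalse e ++ replicateFalse f
replicateFalse-+ zero    f = refl
replicateFalse-+ (suc e) f = cong (false ∷_) (replicateFalse-+ e f)

trues-++-true : ∀ r xs → trues r ++ true ∷ xs ≡ true ∷ trues r ++ xs
trues-++-true zero    xs = refl
trues-++-true (suc r) xs = cong (true ∷_) (trues-++-true r xs)

parkAt-++ : ∀ u t {a} → length u < a → parkAt (u ++ t) a ≡ Maybe.map (u ++_) (parkAt t (a ∸ length u))
parkAt-++ []      t _ = sym (Maybe.map-id _)
parkAt-++ (x ∷ u) t {suc (suc a)} (s≤s u<a) =
  trans (cong (Maybe.map (x ∷_)) (parkAt-++ u t u<a)) (sym (Maybe.map-∘ (parkAt t (suc a ∸ length u))))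

parkAt-trues-++ : ∀ r t {c} → 1 ≤ c → c ≤ suc r → parkAt (trues r ++ t) c ≡ Maybe.map (trues r ++_) (parkAt t 1)
parkAt-trues-++ zero    t {suc zero}    _ _ = sym (Maybe.map-id _)
parkAt-trues-++ zero    t {suc (suc c)} _ (s≤s ())
parkAt-trues-++ (suc r) t {suc zero}    _ _ =
  trans (cong (Maybe.map (true ∷_)) (parkAt-trues-++ r t (s≤s z≤n) (s≤s z≤n))) (sym (Maybe.map-∘ (parkAt t 1)))
parkAt-trues-++ (suc r) t {suc (suc c)} _ (s≤s c≤r) =
  trans (cong (Maybe.map (true ∷_)) (parkAt-trues-++ r t (s≤s z≤n) c≤r)) (sym (Maybe.map-∘ (parkAt t 1)))

street : List Bool → ℕ → ℕ → List Bool
street u r f = u ++ (trues r ++ replicateFalse f)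

length-street : ∀ u r f → length (street u r f) ≡ length u + r + f
length-street u r f = begin
  length (u ++ (trues r ++ replicateFalse f))  ≡⟨ length-++ u ⟩
  length u + length (trues r ++ replicateFalse f)
    ≡⟨ cong (length u +_) (trans (length-++ (trues r)) (cong₂ _+_ (length-trues r) (length-replicateFalse f))) ⟩
  length u + (r + f)                           ≡⟨ sym (+-assoc (length u) r f) ⟩
  length u + r + f                             ∎

parkAt-street-occupied : ∀ u r f {a} → length u < a → a ≤ length u + r →
  parkAt (street u r f) a ≡ Maybe.map (λ t → u ++ (trues r ++ t)) (parkAt (replicateFalse f) 1)
parkAt-street-occupied u r f {a} u<a a≤u+r = begin
  parkAt (u ++ (trues r ++ replicateFalse f)) a
    ≡⟨ parkAt-++ u _ u<a ⟩
  Maybe.map (u ++_) (parkAt (trues r ++ replicateFalse f) (a ∸ length u))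
    ≡⟨ cong (Maybe.map (u ++_)) (parkAt-trues-++ r _ (m<n⇒0<n∸m u<a) a∸u≤1+r) ⟩
  Maybe.map (u ++_) (Maybe.map (trues r ++_) (parkAt (replicateFalse f) 1))
    ≡⟨ sym (Maybe.map-∘ (parkAt (replicateFalse f) 1)) ⟩
  Maybe.map (λ t → u ++ (trues r ++ t)) (parkAt (replicateFalse f) 1) ∎
  where
  a∸u≤1+r : a ∸ length u ≤ suc r
  a∸u≤1+r = m≤n⇒m≤1+n (subst (a ∸ length u ≤_) (m+n∸m≡n (length u) r) (∸-monoˡ-≤ (length u) a≤u+r))

parkAt-street-end : ∀ u r f {a} → length u < a → a ≤ length u + r →
  parkAt (street u r (suc f)) a ≡ just (street u (suc r) f)
parkAt-street-end u r f u<a a≤u+r =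
  trans (parkAt-street-occupied u r (suc f) u<a a≤u+r) (cong (λ t → just (u ++ t)) (trues-++-true r _))

parkAt-street-full : ∀ u r {a} → length u < a → a ≤ length u + r → parkAt (street u r 0) a ≡ nothing
parkAt-street-full u r = parkAt-street-occupied u r 0

parkAt-street-beyond : ∀ u r e f {q} → length u + r ≡ q →
  parkAt (street u r (e + suc f)) (suc (q + e)) ≡ just (street (street u r e) 1 f)
parkAt-street-beyond u r e f {q} u+r≡q = begin
  parkAt (u ++ (trues r ++ replicateFalse (e + suc f))) (suc (q + e))
    ≡⟨ cong (λ s → parkAt s (suc (q + e))) street≡prefix++free ⟩
  parkAt (street u r e ++ false ∷ replicateFalse f) (suc (q + e))
    ≡⟨ parkAt-++ (street u r e) _ (≤-reflexive (cong suc |prefix|≡q+e)) ⟩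
  Maybe.map (street u r e ++_) (parkAt (false ∷ replicateFalse f) (suc (q + e) ∸ length (street u r e)))
    ≡⟨ cong (λ c → Maybe.map (street u r e ++_) (parkAt (false ∷ replicateFalse f) c))
            (trans (cong (suc (q + e) ∸_) |prefix|≡q+e) (m+n∸n≡m 1 (q + e))) ⟩
  just (street u r e ++ true ∷ replicateFalse f) ∎
  where
  |prefix|≡q+e : length (street u r e) ≡ q + e
  |prefix|≡q+e = trans (length-street u r e) (cong (_+ e) u+r≡q)
  street≡prefix++free : u ++ (trues r ++ replicateFalse (e + suc f)) ≡ street u r e ++ false ∷ replicateFalse f
  street≡prefix++free = begin
    u ++ (trues r ++ replicateFalse (e + suc f))
      ≡⟨ cong (λ t → u ++ (trues r ++ t)) (replicateFalse-+ e (suc f)) ⟩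
    u ++ (trues r ++ (replicateFalse e ++ false ∷ replicateFalse f))
      ≡⟨ cong (u ++_) (sym (++-assoc (trues r) _ _)) ⟩
    u ++ ((trues r ++ replicateFalse e) ++ false ∷ replicateFalse f)
      ≡⟨ sym (++-assoc u _ _) ⟩
    street u r e ++ false ∷ replicateFalse f ∎

countCompletions : ℕ → List Bool → ℕ → ℕ → ℕ → ℕ
countCompletions n s b len k = count (λ p → isOrdered (b ∷ p) ∧ (flawsFrom s p ≡ᵇ k)) (sequences n len)

countWithNext : ℕ → List Bool → ℕ → ℕ → ℕ → ℕ
countWithNext n s a len k = count (λ p → isOrdered (a ∷ p) ∧ (flawsFrom s (a ∷ p) ≡ᵇ k)) (sequences n len)

module _ (n : ℕ) (s : List Bool) (a len k : ℕ) where

  countWithNext-parked : ∀ {s′} → parkAt s a ≡ just s′ → countWithNext n s a len k ≡ countCompletions n s′ a len k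
  countWithNext-parked {s′} eq =
    count-cong (sequences n len) (λ p → cong (λ x → isOrdered (a ∷ p) ∧ (x ≡ᵇ k)) (flawsFrom-parked p))
    where
    flawsFrom-parked : ∀ p → flawsFrom s (a ∷ p) ≡ flawsFrom s′ p
    flawsFrom-parked p rewrite eq = refl

  countWithNext-flaw : parkAt s a ≡ nothing → countWithNext n s a len k ≡ atPred (countCompletions n s a len) k
  countWithNext-flaw eq = flaw k
    where
    flawsFrom-flaw : ∀ p → flawsFrom s (a ∷ p) ≡ suc (flawsFrom s p)
    flawsFrom-flaw p rewrite eq = refl
    flaw : ∀ k → countWithNext n s a len k ≡ atPred (countCompletions n s a len) k
    flaw zero    = count-none _ (sequences n len)
      (λ p → trans (cong (λ x → isOrdered (a ∷ p) ∧ (x ≡ᵇ 0)) (flawsFrom-flaw p)) (∧-zeroʳ (isOrdered (a ∷ p))))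
    flaw (suc k) = count-cong (sequences n len) (λ p → cong (λ x → isOrdered (a ∷ p) ∧ (x ≡ᵇ suc k)) (flawsFrom-flaw p))

count≡completions : ∀ len n k u r f b {q} → length u < b → length u + r ≡ q → q + f ≡ n →
  countCompletions n (street u r f) b len k ≡ completions n q b len k
count≡completions zero      n zero    u r f b _ _ _ = refl
count≡completions zero      n (suc k) u r f b _ _ _ = refl
count≡completions (suc len) n k u r f b {q} u<b u+r≡q q+f≡n = trans (count-sequences _ n len) (sumFrom-cong 1 n next)
  where
  u<a : ∀ {a} → b ≤ a → length u < a
  u<a = <-≤-trans u<b

  a≤u+r : ∀ {a} → a ≤ q → a ≤ length u + r
  a≤u+r a≤q = subst (_ ≤_) (sym u+r≡q) a≤q

  atEnd : ∀ f {a} → b ≤ a → a ≤ q → q < n → q + f ≡ n →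
          countWithNext n (street u r f) a len k ≡ completions n (suc q) a len k
  atEnd zero    _   _   q<n q+0≡n = contradiction (trans (sym (+-identityʳ q)) q+0≡n) (<⇒≢ q<n)
  atEnd (suc f) {a} b≤a a≤q _ q+f≡n = trans
    (countWithNext-parked n (street u r (suc f)) a len k (parkAt-street-end u r f (u<a b≤a) (a≤u+r a≤q)))
    (count≡completions len n k u (suc r) f a (u<a b≤a) (trans (+-suc (length u) r) (cong suc u+r≡q))
                       (trans (sym (+-suc q f)) q+f≡n))

  full : ∀ f {a} → b ≤ a → a ≤ q → n ≤ q → q + f ≡ n →
         countWithNext n (street u r f) a len k ≡ atPred (completions n q a len) k
  full (suc f) _   _   n≤q q+f≡n = contradiction (subst (q <_) q+f≡n (m<m+n q (s≤s z≤n))) (≤⇒≯ n≤q)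
  full zero    {a} b≤a a≤q _ q+0≡n = trans
    (countWithNext-flaw n (street u r 0) a len k (parkAt-street-full u r (u<a b≤a) (a≤u+r a≤q)))
    (flawed k)
    where
    flawed : ∀ k → atPred (countCompletions n (street u r 0) a len) k ≡ atPred (completions n q a len) k
    flawed zero    = refl
    flawed (suc k) = count≡completions len n k u r 0 a (u<a b≤a) u+r≡q q+0≡n

  beyond : ∀ {a} → q < a → a ≤ n → countWithNext n (street u r f) a len k ≡ completions n a a len k
  beyond {a} q<a a≤n = trans (countWithNext-parked n (street u r f) a len k parked)
    (count≡completions len n k (street u r e) 1 f′ a (≤-reflexive (trans (+-comm 1 _) |u′|+1≡a)) |u′|+1≡a
                       (m+[n∸m]≡n a≤n))
    where
    e : ℕ
    e = a ∸ suc q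
    f′ : ℕ
    f′ = n ∸ a
    1+q+e≡a : suc (q + e) ≡ a
    1+q+e≡a = m+[n∸m]≡n q<a
    e+1+f′≡f : e + suc f′ ≡ f
    e+1+f′≡f = +-cancelˡ-≡ q _ _ (begin
      q + (e + suc f′)  ≡⟨ cong (q +_) (+-suc e f′) ⟩
      q + suc (e + f′)  ≡⟨ +-suc q _ ⟩
      suc (q + (e + f′)) ≡⟨ cong suc (sym (+-assoc q e f′)) ⟩
      suc (q + e) + f′  ≡⟨ cong (_+ f′) 1+q+e≡a ⟩
      a + f′            ≡⟨ m+[n∸m]≡n a≤n ⟩
      n                 ≡⟨ sym q+f≡n ⟩
      q + f             ∎)
    parked : parkAt (street u r f) a ≡ just (street (street u r e) 1 f′)
    parked = subst₂ (λ g c → parkAt (street u r g) c ≡ just (street (street u r e) 1 f′)) e+1+f′≡f 1+q+e≡a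
                    (parkAt-street-beyond u r e f′ u+r≡q)
    |u′|+1≡a : length (street u r e) + 1 ≡ a
    |u′|+1≡a = begin
      length (street u r e) + 1  ≡⟨ cong (_+ 1) (length-street u r e) ⟩
      length u + r + e + 1       ≡⟨ cong (λ x → x + e + 1) u+r≡q ⟩
      q + e + 1                  ≡⟨ +-comm (q + e) 1 ⟩
      suc (q + e)                ≡⟨ 1+q+e≡a ⟩
      a                          ∎

  next : ∀ a → 1 ≤ a → a < 1 + n →
    count (λ p → isOrdered (b ∷ a ∷ p) ∧ (flawsFrom (street u r f) (a ∷ p) ≡ᵇ k)) (sequences n len) ≡ nextCar n q b len k a
  next a _ a≤n with b ≤ᵇ a in b≤ᵇa
  ... | false = count-none _ (sequences n len) (λ _ → refl)
  ... | true with a ≤ᵇ q in a≤ᵇq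
  ...   | false = beyond (≤ᵇ≡false⇒> a≤ᵇq) (≤-pred a≤n)
  ...   | true with q <ᵇ n in q<ᵇn
  ...     | true  = atEnd f (≤ᵇ≡true⇒≤ b≤ᵇa) (≤ᵇ≡true⇒≤ a≤ᵇq) (<ᵇ≡true⇒< q<ᵇn) q+f≡n
  ...     | false = full f (≤ᵇ≡true⇒≤ b≤ᵇa) (≤ᵇ≡true⇒≤ a≤ᵇq) (<ᵇ≡false⇒≥ q<ᵇn) q+f≡n

-- The recursion for op

counted : ℕ → ℕ → ℕ → List ℕ → Bool
counted n k m p = isOrdered p ∧ (⌊ flaws n p ≟ k ⌋ ∧ leadingIs m p)

op-suc≡sumFrom : ∀ n k m →
  op (suc n) k m ≡ sumFrom (λ a → count (λ p → counted (suc n) k m (a ∷ p)) (sequences (suc n) n)) 1 (suc n)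
op-suc≡sumFrom n k m = trans (length-filter≡count (counted (suc n) k m) (prefSets (suc n))) (count-sequences _ (suc n) n)

count-leading≢ : ∀ N k m a len → a ≢ m → count (λ p → counted N k m (a ∷ p)) (sequences N len) ≡ 0
count-leading≢ N k m a len a≢m = count-none _ (sequences N len) (λ p →
  trans (cong (λ x → isOrdered (a ∷ p) ∧ (⌊ flaws N (a ∷ p) ≟ k ⌋ ∧ x))
              (trans (isYes≗does (a ≟ m)) (dec-false (a ≟ m) a≢m)))
        (trans (cong (isOrdered (a ∷ p) ∧_) (∧-zeroʳ _)) (∧-zeroʳ _)))

op-n<m : ∀ n k m → n < m → op n k m ≡ 0
op-n<m zero    k m _ rewrite length-filter≡count (counted 0 k m) (prefSets 0) | ∧-zeroʳ ⌊ flaws 0 [] ≟ k ⌋ = refl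
op-n<m (suc n) k m n<m = trans (op-suc≡sumFrom n k m)
  (sumFrom-zero 1 (suc n) (λ a _ a≤n → count-leading≢ (suc n) k m a n (<⇒≢ (≤-<-trans (≤-pred a≤n) n<m))))

op≡completions : ∀ n k m → 1 ≤ m → m ≤ suc n → op (suc n) k m ≡ completions (suc n) m m n k
op≡completions n k (suc e) _ m≤N = begin
  op N k m
    ≡⟨ op-suc≡sumFrom n k m ⟩
  sumFrom (λ a → count (λ p → counted N k m (a ∷ p)) (sequences N n)) 1 N
    ≡⟨ sumFrom-single m N (s≤s z≤n) m≤N (λ a _ _ a≢m → count-leading≢ N k m a n a≢m) ⟩
  count (λ p → counted N k m (m ∷ p)) (sequences N n)
    ≡⟨ count-cong (sequences N n) counted-leading≡ ⟩
  countWithNext N (replicateFalse N) m n k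
    ≡⟨ countWithNext-parked N (replicateFalse N) m n k firstCarParks ⟩
  countCompletions N (street (replicateFalse e) 1 f) m n k
    ≡⟨ count≡completions n N k (replicateFalse e) 1 f m |u|<m |u|+1≡m (m+[n∸m]≡n m≤N) ⟩
  completions N m m n k ∎
  where
  N : ℕ
  N = suc n
  m : ℕ
  m = suc e
  f : ℕ
  f = N ∸ m
  counted-leading≡ : ∀ p → counted N k m (m ∷ p) ≡ isOrdered (m ∷ p) ∧ (flawsFrom (replicateFalse N) (m ∷ p) ≡ᵇ k)
  counted-leading≡ p = cong (isOrdered (m ∷ p) ∧_) (begin
    ⌊ flaws N (m ∷ p) ≟ k ⌋ ∧ ⌊ m ≟ m ⌋
      ≡⟨ cong₂ _∧_ (isYes≗does (flaws N (m ∷ p) ≟ k)) (trans (isYes≗does (m ≟ m)) (dec-true (m ≟ m) refl)) ⟩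
    (flaws N (m ∷ p) ≡ᵇ k) ∧ true
      ≡⟨ ∧-identityʳ _ ⟩
    flaws N (m ∷ p) ≡ᵇ k ∎)
  firstCarParks : parkAt (replicateFalse N) m ≡ just (street (replicateFalse e) 1 f)
  firstCarParks = subst (λ g → parkAt (replicateFalse g) m ≡ just (street (replicateFalse e) 1 f))
                (trans (+-suc e f) (m+[n∸m]≡n m≤N))
                (parkAt-street-beyond [] 0 e f refl)
  |u|+1≡m : length (replicateFalse e) + 1 ≡ m
  |u|+1≡m = trans (cong (_+ 1) (length-replicateFalse e)) (+-comm e 1)
  |u|<m : length (replicateFalse e) < m
  |u|<m = ≤-reflexive (trans (+-comm 1 _) |u|+1≡m)

op-n<k : ∀ n k j → 1 ≤ j → n < k → op n k j ≡ 0
op-n<k zero    k j 1≤j _   = op-n<m 0 k j 1≤j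
op-n<k (suc n) k j 1≤j n<k with j ≤? suc n
... | yes j≤n = trans (op≡completions n k j 1≤j j≤n) (completions-len<k n (suc n) j j k (<-trans (n<1+n n) n<k))
... | no  j≰n = op-n<m (suc n) k j (≰⇒> j≰n)

op-1+k<j : ∀ n k j → suc k < j → op n k j ≡ 0
op-1+k<j zero    k j k<j = op-n<m 0 k j (<-trans (s≤s z≤n) k<j)
op-1+k<j (suc n) k j k<j with j ≤? suc n
... | no  j≰n = op-n<m (suc n) k j (≰⇒> j≰n)
... | yes j≤n = trans (op≡completions n k j (<-trans (s≤s z≤n) k<j) j≤n)
  (completions-free<len∸k n (suc n) j j k (suc n ∸ j) (m+[n∸m]≡n j≤n)
    (≤-pred (subst (suc (suc k) + (suc n ∸ j) ≤_) (m+[n∸m]≡n j≤n) (+-monoˡ-≤ (suc n ∸ j) k<j))))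

jumpCompletions-shift : ∀ i N q L k → jumpCompletions (i + N) (i + q) L k ≡ jumpCompletions N q L k
jumpCompletions-shift i N q L k = begin
  sumFrom g (suc (suc (i + q))) (i + N ∸ suc (i + q))
    ≡⟨ cong₂ (sumFrom g) (sym (trans (+-suc i (suc q)) (cong suc (+-suc i q))))
                         (trans (cong (i + N ∸_) (sym (+-suc i q))) ([m+n]∸[m+o]≡n∸o i N (suc q))) ⟩
  sumFrom g (i + suc (suc q)) (N ∸ suc q)
    ≡⟨ sumFrom-shift g i (suc (suc q)) (N ∸ suc q) ⟩
  sumFrom (λ a → g (i + a)) (suc (suc q)) (N ∸ suc q)
    ≡⟨ sumFrom-cong (suc (suc q)) (N ∸ suc q) (λ a q<a _ → completions-shift L i N a a k (<-trans (s≤s z≤n) q<a)) ⟩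
  jumpCompletions N q L k ∎
  where
  g : ℕ → ℕ
  g a = completions (i + N) a a L k

jumpCompletions≡sum-op : ∀ L q k → q ≤ L →
  jumpCompletions (suc L) q L k ≡ sumFrom (λ j → op (suc L) k j) (suc (suc q)) (L ∸ q)
jumpCompletions≡sum-op L q k q≤L = sumFrom-cong (suc (suc q)) (L ∸ q) (λ a q<a a≤L →
  sym (op≡completions L k a (<-trans (s≤s z≤n) q<a) (≤-pred (subst (a <_) (cong (2 +_) (m+[n∸m]≡n q≤L)) a≤L))))

op≡catalan-sum : ∀ n k m → 1 ≤ m → m ≤ suc n → suc k ≢ m →
  op (suc n) k m ≡ sumFrom (λ i → catalan i * sumFrom (λ j → op (suc n ∸ i) k j) (suc m) (suc n ∸ i ∸ m)) 1 (suc n ∸ m)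
op≡catalan-sum n k (suc e) _ m≤1+n 1+k≢m = begin
  op (suc n) k m
    ≡⟨ op≡completions n k m (s≤s z≤n) m≤1+n ⟩
  completions (suc n) m m n k
    ≡⟨ completions≡ballot-sum (suc n) m m 1 n k (n ∸ e) (m+[n∸m]≡n m≤1+n) (+-comm m 1) (s≤s z≤n)
                              (m∸n≤m n e) k≢n∸[n∸e] ⟩
  sumFrom (λ s → ballot 1 s * jumpCompletions (suc n) (m + s) (n ∸ suc s) k) 0 (n ∸ e)
    ≡⟨ sumFrom-cong 0 (n ∸ e) (λ s _ s<n∸e → cong₂ _*_ (sym (catalan-suc≡ballot1 s)) (jumps≡sum-op s s<n∸e)) ⟩
  sumFrom (λ s → h (suc s)) 0 (n ∸ e)
    ≡⟨ sym (sumFrom-shift h 1 0 (n ∸ e)) ⟩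
  sumFrom h 1 (n ∸ e) ∎
  where
  m : ℕ
  m = suc e
  e≤n : e ≤ n
  e≤n = ≤-pred m≤1+n
  h : ℕ → ℕ
  h i = catalan i * sumFrom (λ j → op (suc n ∸ i) k j) (suc m) (suc n ∸ i ∸ m)
  k≢n∸[n∸e] : k ≢ n ∸ (n ∸ e)
  k≢n∸[n∸e] k≡ = 1+k≢m (cong suc (trans k≡ (m∸[m∸n]≡n e≤n)))
  jumps≡sum-op : ∀ s → s < n ∸ e →
    jumpCompletions (suc n) (m + s) (n ∸ suc s) k ≡ sumFrom (λ j → op (n ∸ s) k j) (suc m) (n ∸ s ∸ m)
  jumps≡sum-op s s<n∸e = begin
    jumpCompletions (suc n) (m + s) L k
      ≡⟨ cong₂ (λ x y → jumpCompletions x y L k) (cong suc n≡s+1+L) (cong suc (+-comm e s)) ⟩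
    jumpCompletions (suc s + suc L) (suc s + e) L k
      ≡⟨ jumpCompletions-shift (suc s) (suc L) e L k ⟩
    jumpCompletions (suc L) e L k
      ≡⟨ jumpCompletions≡sum-op L e k e≤L ⟩
    sumFrom (λ j → op (suc L) k j) (suc m) (suc L ∸ m)
      ≡⟨ cong (λ x → sumFrom (λ j → op x k j) (suc m) (x ∸ m)) (sym n∸s≡1+L) ⟩
    sumFrom (λ j → op (n ∸ s) k j) (suc m) (n ∸ s ∸ m) ∎
    where
    L : ℕ
    L = n ∸ suc s
    1+s+e≤n : suc s + e ≤ n
    1+s+e≤n = m≤o∸n⇒m+n≤o (suc s) e≤n s<n∸e
    n∸s≡1+L : n ∸ s ≡ suc L
    n∸s≡1+L = +-∸-assoc 1 (≤-trans (m≤m+n (suc s) e) 1+s+e≤n)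
    n≡s+1+L : n ≡ s + suc L
    n≡s+1+L = trans (sym (m+[n∸m]≡n (≤-trans (m≤m+n s (suc e)) (subst (_≤ n) (sym (+-suc s e)) 1+s+e≤n))))
                    (cong (s +_) n∸s≡1+L)
    e≤L : e ≤ L
    e≤L = m+n≤o⇒m≤o∸n e (subst (_≤ n) (+-comm (suc s) e) 1+s+e≤n)

[n∸k]+[k∸m]≡n∸m : ∀ {n k m} → m ≤ k → k ≤ n → (n ∸ k) + (k ∸ m) ≡ n ∸ m
[n∸k]+[k∸m]≡n∸m {n} {k} {m} m≤k k≤n = trans (sym (+-∸-assoc (n ∸ k) m≤k)) (cong (_∸ m) (m∸n+n≡m k≤n))

sumFrom-op-leading≤1+k : ∀ N k m → m ≤ k → k ≤ N →
  sumFrom (λ j → op N k j) (suc m) (N ∸ m) ≡ sumFrom (λ j → op N k j) (suc m) (suc k ∸ m)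
sumFrom-op-leading≤1+k N k m m≤k k≤N with N ≤? k
... | yes N≤k rewrite ≤-antisym N≤k k≤N =
  sym (trans (cong (sumFrom (op k k) (suc m)) (trans (+-∸-assoc 1 m≤k) (+-comm 1 (k ∸ m))))
             (sumFrom-truncate (suc m) (k ∸ m) 1 (λ j k<j _ → op-n<m k k j (subst (_≤ j) 1+m+[k∸m]≡1+k k<j))))
  where
  1+m+[k∸m]≡1+k : suc m + (k ∸ m) ≡ suc k
  1+m+[k∸m]≡1+k = cong suc (m+[n∸m]≡n m≤k)
... | no  N≰k = begin
  sumFrom (op N k) (suc m) (N ∸ m)                      ≡⟨ cong (sumFrom (op N k) (suc m)) N∸m≡[1+k∸m]+[N∸1+k] ⟩
  sumFrom (op N k) (suc m) ((suc k ∸ m) + (N ∸ suc k))  ≡⟨ sumFrom-truncate (suc m) (suc k ∸ m) (N ∸ suc k) beyond≡0 ⟩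
  sumFrom (op N k) (suc m) (suc k ∸ m)                  ∎
  where
  m≤1+k : m ≤ suc k
  m≤1+k = m≤n⇒m≤1+n m≤k
  N∸m≡[1+k∸m]+[N∸1+k] : N ∸ m ≡ (suc k ∸ m) + (N ∸ suc k)
  N∸m≡[1+k∸m]+[N∸1+k] = sym (trans (+-comm (suc k ∸ m) _) ([n∸k]+[k∸m]≡n∸m m≤1+k (≰⇒> N≰k)))
  beyond≡0 : ∀ j → suc m + (suc k ∸ m) ≤ j → j < suc m + (suc k ∸ m) + (N ∸ suc k) → op N k j ≡ 0
  beyond≡0 j k<j _ = op-1+k<j N k j (subst (_≤ j) (cong suc (m+[n∸m]≡n m≤1+k)) k<j)

catalan-sum-truncate : ∀ N k m → 1 ≤ m → m ≤ k → k ≤ N →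
  sumFrom (λ i → catalan i * sumFrom (λ j → op (N ∸ i) k j) (suc m) (N ∸ i ∸ m)) 1 (N ∸ m) ≡
  sumFrom (λ i → catalan i * sumFrom (λ j → op (N ∸ i) k j) (suc m) (suc k ∸ m)) 1 (N ∸ k)
catalan-sum-truncate N k m 1≤m m≤k k≤N = begin
  sumFrom (λ i → catalan i * inner i (N ∸ i ∸ m)) 1 (N ∸ m)
    ≡⟨ cong (sumFrom _ 1) (sym ([n∸k]+[k∸m]≡n∸m m≤k k≤N)) ⟩
  sumFrom (λ i → catalan i * inner i (N ∸ i ∸ m)) 1 ((N ∸ k) + (k ∸ m))
    ≡⟨ sumFrom-truncate 1 (N ∸ k) (k ∸ m) (λ i N∸k<i _ → trans (cong (catalan i *_) (inner≡0 i N∸k<i)) (*-zeroʳ (catalan i))) ⟩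
  sumFrom (λ i → catalan i * inner i (N ∸ i ∸ m)) 1 (N ∸ k)
    ≡⟨ sumFrom-cong 1 (N ∸ k) (λ i _ i≤N∸k → cong (catalan i *_) (sumFrom-op-leading≤1+k (N ∸ i) k m m≤k (k≤N∸i i i≤N∸k))) ⟩
  sumFrom (λ i → catalan i * inner i (suc k ∸ m)) 1 (N ∸ k) ∎
  where
  inner : ℕ → ℕ → ℕ
  inner i = sumFrom (λ j → op (N ∸ i) k j) (suc m)
  k≤N∸i : ∀ i → i < 1 + (N ∸ k) → k ≤ N ∸ i
  k≤N∸i i i≤N∸k = m+n≤o⇒m≤o∸n k (subst (_≤ N) (+-comm i k) (m≤o∸n⇒m+n≤o i k≤N (≤-pred i≤N∸k)))
  inner≡0 : ∀ i → 1 + (N ∸ k) ≤ i → inner i (N ∸ i ∸ m) ≡ 0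
  inner≡0 i N∸k<i = sumFrom-zero (suc m) (N ∸ i ∸ m) (λ j m<j _ → op-n<k (N ∸ i) k j (≤-trans 1≤m (<⇒≤ m<j)) N∸i<k)
    where
    N∸i<k : N ∸ i < k
    N∸i<k = m<n+o⇒m∸n<o N i {{>-nonZero (≤-trans 1≤m m≤k)}} (subst (_< i + k) (m∸n+n≡m k≤N) (+-monoˡ-< k N∸k<i))

mainTheorem11 : (n k m : ℕ) → 1 ≤ m → m ≤ k → suc k ≤ n →
  op n k m ≡ sumRange (suc m) (suc k) (λ j → sumRange 1 (n ∸ k) (λ i → catalan i * op (n ∸ i) k j))
mainTheorem11 zero    k m _   _   ()
mainTheorem11 (suc n) k m 1≤m m≤k k<n = begin
  op (suc n) k m
    ≡⟨ op≡catalan-sum n k m 1≤m (≤-trans m≤k k≤1+n) (>⇒≢ (s≤s m≤k)) ⟩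
  sumFrom (λ i → catalan i * sumFrom (λ j → op (suc n ∸ i) k j) (suc m) (suc n ∸ i ∸ m)) 1 (suc n ∸ m)
    ≡⟨ catalan-sum-truncate (suc n) k m 1≤m m≤k k≤1+n ⟩
  sumFrom (λ i → catalan i * sumFrom (λ j → op (suc n ∸ i) k j) (suc m) (suc k ∸ m)) 1 (suc n ∸ k)
    ≡⟨ sumFrom-cong 1 (suc n ∸ k) (λ i _ _ → sym (sumFrom-*ˡ (catalan i) (λ j → op (suc n ∸ i) k j) (suc m) (suc k ∸ m))) ⟩
  sumFrom (λ i → sumFrom (λ j → catalan i * op (suc n ∸ i) k j) (suc m) (suc k ∸ m)) 1 (suc n ∸ k)
    ≡⟨ sym (sumRange-comm (suc m) (suc k) 1 (suc n ∸ k) (λ i j → catalan i * op (suc n ∸ i) k j)) ⟩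
  sumRange (suc m) (suc k) (λ j → sumRange 1 (suc n ∸ k) (λ i → catalan i * op (suc n ∸ i) k j)) ∎
  where
  k≤1+n : k ≤ suc n
  k≤1+n = <⇒≤ k<n
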